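{- Let $p\le q$ be positive integers. The complete bipartite graph $K_{p,q}$ is a TRVG if and only if $p\le 2$ or $(p,q)\in\{(3,3),(3,4)\}$.
   Context: A graph $G$ is a transparent rectangle visibility graph (TRVG) if there is a collection of rectangles in the plane with sides parallel to the coordinate axes and pairwise disjoint interiors, one rectangle $R_v$ for each vertex $v$, such that for distinct vertices $u,v$: $u$ and $v$ are adjacent if and only if there is a horizontal or a vertical line meeting the interiors of both $R_u$ and $R_v$ (other rectangles in between do not block visibility).
   Formalization: The rectangles representing the vertices are taken with rational corner coordinates, lying in ℚ² instead of the real plane. -}

module Defs where

open import Level using (0ℓ)
open import Data.Nat using (ℕ)
open import Data.Fin using (Fin)
open import Data.Sum using (_⊎_; inj₁; inj₂)
open import Data.Product using (_×_; Σ)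
open import Data.Empty using (⊥)
open import Data.Unit using (⊤)
open import Data.Rational using (ℚ; _<_)
open import Relation.Nullary using (¬_)
open import Relation.Binary.PropositionalEquality using (_≡_)
open import Function.Bundles using (_⇔_)

record Rect : Set where
  field
    x₁ x₂ y₁ y₂ : ℚ
    x₁<x₂ : x₁ < x₂
    y₁<y₂ : y₁ < y₂
open Rect public

OpenOverlap : ℚ → ℚ → ℚ → ℚ → Set
OpenOverlap a b c d = (a < d) × (c < b)

XOverlap : Rect → Rect → Set
XOverlap R S = OpenOverlap (x₁ R) (x₂ R) (x₁ S) (x₂ S)

YOverlap : Rect → Rect → Set
YOverlap R S = OpenOverlap (y₁ R) (y₂ R) (y₁ S) (y₂ S)

InteriorsMeet : Rect → Rect → Set
InteriorsMeet R S = XOverlap R S × YOverlap R S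

-- Transparent visibility: a horizontal or a vertical line meets both interiors.
Visible : Rect → Rect → Set
Visible R S = YOverlap R S ⊎ XOverlap R S

IsTRVG : (V : Set) → (V → V → Set) → Set
IsTRVG V E =
  Σ (V → Rect) λ R →
    (∀ u v → ¬ (u ≡ v) → ¬ InteriorsMeet (R u) (R v)) ×
    (∀ u v → ¬ (u ≡ v) → (E u v ⇔ Visible (R u) (R v)))

KAdj : (p q : ℕ) → Fin p ⊎ Fin q → Fin p ⊎ Fin q → Set
KAdj p q (inj₁ _) (inj₁ _) = ⊥
KAdj p q (inj₁ _) (inj₂ _) = ⊤
KAdj p q (inj₂ _) (inj₁ _) = ⊤
KAdj p q (inj₂ _) (inj₂ _) = ⊥

K-TRVG : ℕ → ℕ → Set
K-TRVG p q = IsTRVG (Fin p ⊎ Fin q) (KAdj p q)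

{-# OPTIONS --safe #-}
-- Every edge of a represented K_{p,q} is witnessed by overlapping x- or y-projections, while on
-- each axis the projections of one side are pairwise disjoint intervals. Charging an overlapping
-- pair to the member whose interval ends first is therefore injective, and it never charges the
-- interval that ends last; so each axis witnesses at most p + q - 1 edges and pq + 2 ≤ 2(p + q),
-- which for 3 ≤ p ≤ q forces (p, q) ∈ {(3,3), (3,4)}. Conversely K_{2,q} and K_{3,4} have explicit
-- layouts, and layouts restrict to induced subgraphs.
module Submission where

open import Defs
open import Data.Nat using (ℕ; _≤_)
open import Data.Sum using (_⊎_)
open import Data.Product using (_×_)
open import Relation.Binary.PropositionalEquality using (_≡_)
open import Function.Bundles using (_⇔_)

open import Data.Nat as ℕ using (suc; z≤n; s≤s; z<s; s≤s⁻¹; _+_; _*_; _≤?_)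
open import Data.Nat.Properties
  using ( ≤-refl; ≤-trans; ≤-antisym; <⇒≤; ≰⇒>; n<1+n; n≤1+n; suc-injective; m<m+n
        ; +-mono-≤; +-monoˡ-≤; +-cancelˡ-≤; *-cancelʳ-<; m≤n⇒m<n∨m≡n; module ≤-Reasoning)
open import Data.Nat.Tactic.RingSolver using (solve)
open import Data.Integer as ℤ using (+_; +<+)
open import Data.Integer.Properties using (*-identityʳ; drop‿+<+)
open import Data.Rational as ℚ using (ℚ)
open import Data.Rational.Literals using (fromℤ)
import Data.Rational.Properties as ℚ
open import Data.Fin using (Fin; zero; suc; toℕ; fromℕ<; inject≤; _≟_)
open import Data.Fin.Properties using (toℕ-injective; toℕ<n; inject≤-injective; all?; +↔⊎; *↔×; injective⇒≤)
open import Data.List using (allFin; _∷_; [])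
open import Data.List.Relation.Unary.All using (lookup)
open import Data.List.Membership.Propositional.Properties using (∈-allFin)
open import Relation.Binary.Bundles using (DecTotalOrder)
open import Data.List.Extrema (DecTotalOrder.totalOrder ℚ.≤-decTotalOrder) using (argmax; f[xs]≤f[argmax])
open import Data.Sum as Sum using (inj₁; inj₂; [_,_])
open import Data.Sum.Properties using (inj₁-injective; inj₂-injective; ≡-dec)
open import Data.Sum.Function.Propositional using (_⊎-↔_)
open import Data.Product as Product using (Σ; _,_; proj₁; proj₂; swap)
open import Data.Empty using (⊥-elim)
open import Data.Unit using (tt)
open import Relation.Nullary using (¬_; Dec; yes; no; contradiction)
open import Relation.Nullary.Decidable using (_×-dec_; _⊎-dec_; _→-dec_; ¬?; from-yes; decidable-stable)
open import Relation.Binary.PropositionalEquality using (_≢_; refl; sym; cong; subst₂)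
open import Function using (_∘_; const; Injective; Injection; Equivalence; _↣_; _↔_; mk⇔; mk↣)
open import Function.Construct.Composition using (_↣-∘_)
open import Function.Properties.Inverse using (↔⇒↣; ↔-sym; ↔-trans; ↔-refl)

fromℕ : ℕ → ℚ
fromℕ n = fromℤ (+ n)

fromℕ-mono-< : ∀ {m n} → m ℕ.< n → fromℕ m ℚ.< fromℕ n
fromℕ-mono-< {m} {n} m<n =
  ℚ.*<* (subst₂ ℤ._<_ (sym (*-identityʳ (+ m))) (sym (*-identityʳ (+ n))) (+<+ m<n))

fromℕ-cancel-< : ∀ {m n} → fromℕ m ℚ.< fromℕ n → m ℕ.< n
fromℕ-cancel-< {m} {n} (ℚ.*<* m<n) =
  drop‿+<+ (subst₂ ℤ._<_ (*-identityʳ (+ m)) (*-identityʳ (+ n)) m<n)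

record Representation (p q : ℕ) : Set where
  field
    left         : Fin p → Rect
    right        : Fin q → Rect
    left-hidden  : ∀ i i' → Visible (left i) (left i') → i ≡ i'
    right-hidden : ∀ j j' → Visible (right j) (right j') → j ≡ j'
    visible      : ∀ i j → Visible (left i) (right j)
    disjoint     : ∀ i j → ¬ InteriorsMeet (left i) (right j)

K-TRVG⇔Representation : ∀ {p q} → K-TRVG p q ⇔ Representation p q
K-TRVG⇔Representation {p} {q} = mk⇔ fromTRVG toTRVG
  where
  fromTRVG : K-TRVG p q → Representation p q
  fromTRVG (R , disj , adj) = record
    { left         = R ∘ inj₁
    ; right        = R ∘ inj₂
    ; left-hidden  = λ i i' → inj₁-injective ∘ nonadjacent-hidden (inj₁ i) (inj₁ i') λ ()
    ; right-hidden = λ j j' → inj₂-injective ∘ nonadjacent-hidden (inj₂ j) (inj₂ j') λ ()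
    ; visible      = λ i j → Equivalence.to (adj (inj₁ i) (inj₂ j) λ ()) tt
    ; disjoint     = λ i j → disj (inj₁ i) (inj₂ j) λ ()
    }
    where
    nonadjacent-hidden : ∀ u v → ¬ KAdj p q u v → Visible (R u) (R v) → u ≡ v
    nonadjacent-hidden u v ¬uv vis =
      decidable-stable (≡-dec _≟_ _≟_ u v) λ u≢v → ¬uv (Equivalence.from (adj u v u≢v) vis)

  toTRVG : Representation p q → K-TRVG p q
  toTRVG ρ = R , disj , adj
    where
    open Representation ρ
    R : Fin p ⊎ Fin q → Rect
    R = [ left , right ]

    disj : ∀ u v → u ≢ v → ¬ InteriorsMeet (R u) (R v)
    disj (inj₁ i) (inj₁ i') i≢i' m = i≢i' (cong inj₁ (left-hidden i i' (inj₁ (proj₂ m))))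
    disj (inj₂ j) (inj₂ j') j≢j' m = j≢j' (cong inj₂ (right-hidden j j' (inj₁ (proj₂ m))))
    disj (inj₁ i) (inj₂ j) _ m = disjoint i j m
    disj (inj₂ j) (inj₁ i) _ m = disjoint i j (Product.map swap swap m)

    adj : ∀ u v → u ≢ v → KAdj p q u v ⇔ Visible (R u) (R v)
    adj (inj₁ i) (inj₁ i') i≢i' = mk⇔ ⊥-elim (λ v → i≢i' (cong inj₁ (left-hidden i i' v)))
    adj (inj₂ j) (inj₂ j') j≢j' = mk⇔ ⊥-elim (λ v → j≢j' (cong inj₂ (right-hidden j j' v)))
    adj (inj₁ i) (inj₂ j) _ = mk⇔ (const (visible i j)) (const tt)
    adj (inj₂ j) (inj₁ i) _ = mk⇔ (const (Sum.map swap swap (visible i j))) (const tt)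

restrict : ∀ {m n p q} → m ≤ p → n ≤ q → Representation p q → Representation m n
restrict m≤p n≤q ρ = record
  { left         = λ i → left (inject≤ i m≤p)
  ; right        = λ j → right (inject≤ j n≤q)
  ; left-hidden  = λ i i' → inject≤-injective m≤p m≤p i i' ∘ left-hidden _ _
  ; right-hidden = λ j j' → inject≤-injective n≤q n≤q j j' ∘ right-hidden _ _
  ; visible      = λ i j → visible _ _
  ; disjoint     = λ i j → disjoint _ _
  }
  where open Representation ρ

box : (a b c d : ℕ) → a ℕ.< b → c ℕ.< d → Rect
box a b c d a<b c<d = record
  { x₁ = fromℕ a ; x₂ = fromℕ b ; y₁ = fromℕ c ; y₂ = fromℕ d
  ; x₁<x₂ = fromℕ-mono-< a<b ; y₁<y₂ = fromℕ-mono-< c<d }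

fromℕ-overlap : ∀ {a b c d} → a ℕ.< d → c ℕ.< b → OpenOverlap (fromℕ a) (fromℕ b) (fromℕ c) (fromℕ d)
fromℕ-overlap a<d c<b = fromℕ-mono-< a<d , fromℕ-mono-< c<b

fromℕ-overlap⁻¹ : ∀ {a b c d} → OpenOverlap (fromℕ a) (fromℕ b) (fromℕ c) (fromℕ d) → a ℕ.< d × c ℕ.< b
fromℕ-overlap⁻¹ (a<d , c<b) = fromℕ-cancel-< a<d , fromℕ-cancel-< c<b

unit-square : ℕ → Rect
unit-square n = box n (suc n) n (suc n) (n<1+n n) (n<1+n n)

unit-overlap⇒≡ : ∀ {m n} → OpenOverlap (fromℕ m) (fromℕ (suc m)) (fromℕ n) (fromℕ (suc n)) → m ≡ n
unit-overlap⇒≡ o with fromℕ-overlap⁻¹ o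
... | s≤s m≤n , s≤s n≤m = ≤-antisym m≤n n≤m

K₂,q-representation : ∀ q → Representation 2 q
K₂,q-representation q = record
  { left         = bar
  ; right        = cell
  ; left-hidden  = bars-hidden
  ; right-hidden = λ j j' v → toℕ-injective (suc-injective (unit-overlap⇒≡ (Sum.reduce v)))
  ; visible      = bar-visible
  ; disjoint     = bar-disjoint
  }
  where
  bar : Fin 2 → Rect
  bar zero       = box 1 (2 + q) 0 1 (s≤s (s≤s z≤n)) (s≤s z≤n)
  bar (suc zero) = box 0 1 1 (2 + q) (s≤s z≤n) (s≤s (s≤s z≤n))

  cell : Fin q → Rect
  cell j = unit-square (suc (toℕ j))

  bars-hidden : ∀ i i' → Visible (bar i) (bar i') → i ≡ i'
  bars-hidden zero       zero       _ = refl
  bars-hidden (suc zero) (suc zero) _ = refl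
  bars-hidden zero       (suc zero) (inj₁ (_ , 1<1)) = contradiction 1<1 (ℚ.<-irrefl refl)
  bars-hidden zero       (suc zero) (inj₂ (1<1 , _)) = contradiction 1<1 (ℚ.<-irrefl refl)
  bars-hidden (suc zero) zero       (inj₁ (1<1 , _)) = contradiction 1<1 (ℚ.<-irrefl refl)
  bars-hidden (suc zero) zero       (inj₂ (_ , 1<1)) = contradiction 1<1 (ℚ.<-irrefl refl)

  along-bar : ∀ j → OpenOverlap (fromℕ 1) (fromℕ (2 + q)) (fromℕ (suc (toℕ j))) (fromℕ (2 + toℕ j))
  along-bar j = fromℕ-overlap (s≤s (s≤s z≤n)) (s≤s (s≤s (<⇒≤ (toℕ<n j))))

  across-bar : ∀ j → ¬ OpenOverlap (fromℕ 0) (fromℕ 1) (fromℕ (suc (toℕ j))) (fromℕ (2 + toℕ j))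
  across-bar j o with fromℕ-overlap⁻¹ o
  ... | _ , s≤s ()

  bar-visible : ∀ i j → Visible (bar i) (cell j)
  bar-visible zero       j = inj₂ (along-bar j)
  bar-visible (suc zero) j = inj₁ (along-bar j)

  bar-disjoint : ∀ i j → ¬ InteriorsMeet (bar i) (cell j)
  bar-disjoint zero       j (_ , y) = across-bar j y
  bar-disjoint (suc zero) j (x , _) = across-bar j x

OpenOverlap? : ∀ a b c d → Dec (OpenOverlap a b c d)
OpenOverlap? a b c d = (a ℚ.<? d) ×-dec (c ℚ.<? b)

Visible? : ∀ R S → Dec (Visible R S)
Visible? R S = OpenOverlap? (y₁ R) (y₂ R) (y₁ S) (y₂ S) ⊎-dec OpenOverlap? (x₁ R) (x₂ R) (x₁ S) (x₂ S)

InteriorsMeet? : ∀ R S → Dec (InteriorsMeet R S)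
InteriorsMeet? R S = OpenOverlap? (x₁ R) (x₂ R) (x₁ S) (x₂ S) ×-dec OpenOverlap? (y₁ R) (y₂ R) (y₁ S) (y₂ S)

hidden? : ∀ {n} (f : Fin n → Rect) → Dec (∀ i i' → Visible (f i) (f i') → i ≡ i')
hidden? f = all? λ i → all? λ i' → Visible? (f i) (f i') →-dec i ≟ i'

square : ℕ → ℕ → Rect
square x y = box x (x + 3) y (y + 3) (m<m+n x z<s) (m<m+n y z<s)

K₃,₄-representation : Representation 3 4
K₃,₄-representation = record
  { left         = diagonal
  ; right        = off-diagonal
  ; left-hidden  = from-yes (hidden? diagonal)
  ; right-hidden = from-yes (hidden? off-diagonal)
  ; visible      = from-yes (all? λ i → all? λ j → Visible? (diagonal i) (off-diagonal j))
  ; disjoint     = from-yes (all? λ i → all? λ j → ¬? (InteriorsMeet? (diagonal i) (off-diagonal j)))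
  }
  where
  -- Each diagonal square meets two off-diagonal squares in x-projection and the other two in
  -- y-projection.
  diagonal : Fin 3 → Rect
  diagonal i = square (2 + 4 * toℕ i) (2 + 4 * toℕ i)

  off-diagonal : Fin 4 → Rect
  off-diagonal zero                   = square 0 8
  off-diagonal (suc zero)             = square 4 12
  off-diagonal (suc (suc zero))       = square 8 0
  off-diagonal (suc (suc (suc zero))) = square 12 4

outlasting-overlap : ∀ {a b c d e f} → OpenOverlap a b e f → OpenOverlap c d e f →
                     f ℚ.≤ b → f ℚ.≤ d → OpenOverlap a b c d
outlasting-overlap (a<f , _) (c<f , _) f≤b f≤d = ℚ.<-≤-trans a<f f≤d , ℚ.<-≤-trans c<f f≤b

Overlap : (lo hi : Rect → ℚ) → Rect → Rect → Set
Overlap lo hi R S = OpenOverlap (lo R) (hi R) (lo S) (hi S)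

module Charging (lo hi : Rect → ℚ) {I J : Set} (A : I → Rect) (B : J → Rect)
  (A-apart : ∀ {i i'} → Overlap lo hi (A i) (A i') → i ≡ i')
  (B-apart : ∀ {j j'} → Overlap lo hi (B j) (B j') → j ≡ j') where

  charge : I → J → I ⊎ J
  charge i j with hi (A i) ℚ.≤? hi (B j)
  ... | yes _ = inj₁ i
  ... | no _  = inj₂ j

  charge≡inj₁ : ∀ {i j i'} → charge i j ≡ inj₁ i' → i ≡ i' × hi (A i) ℚ.≤ hi (B j)
  charge≡inj₁ {i} {j} c with hi (A i) ℚ.≤? hi (B j)
  ... | yes i≤j = inj₁-injective c , i≤j
  ... | no _    = contradiction c λ ()

  charge≡inj₂ : ∀ {i j j'} → charge i j ≡ inj₂ j' → j ≡ j' × hi (B j) ℚ.< hi (A i)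
  charge≡inj₂ {i} {j} c with hi (A i) ℚ.≤? hi (B j)
  ... | yes _   = contradiction c λ ()
  ... | no i≰j = inj₂-injective c , ℚ.≰⇒> i≰j

  charge-injective : ∀ {i j i' j'} → Overlap lo hi (A i) (B j) → Overlap lo hi (A i') (B j') →
                     charge i j ≡ charge i' j' → (i , j) ≡ (i' , j')
  charge-injective {i} {j} {i'} {j'} o o' c with charge i j in c₀
  ... | inj₁ _ with charge≡inj₁ c₀ | charge≡inj₁ (sym c)
  ...   | refl , i≤j | refl , i≤j' = cong (i ,_) (B-apart (outlasting-overlap (swap o) (swap o') i≤j i≤j'))
  charge-injective {i} {j} {i'} {j'} o o' c | inj₂ _ with charge≡inj₂ c₀ | charge≡inj₂ (sym c)
  ...   | refl , j<i | refl , j<i' = cong (_, j) (A-apart (outlasting-overlap o o' (ℚ.<⇒≤ j<i) (ℚ.<⇒≤ j<i')))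

  charge-misses : (Σ I λ a* → ∀ i → hi (A i) ℚ.≤ hi (A a*)) → (Σ J λ b* → ∀ j → hi (B j) ℚ.≤ hi (B b*)) →
                  Σ (I ⊎ J) λ v → ∀ i j → charge i j ≢ v
  charge-misses (a* , a*-max) (b* , b*-max) with hi (A a*) ℚ.≤? hi (B b*)
  ... | yes a*≤b* = inj₂ b* , b*-uncharged
    where
    b*-uncharged : ∀ i j → charge i j ≢ inj₂ b*
    b*-uncharged i j c with charge≡inj₂ c
    ... | refl , b*<i = ℚ.<-irrefl refl (ℚ.<-≤-trans b*<i (ℚ.≤-trans (a*-max i) a*≤b*))
  ... | no a*≰b* = inj₁ a* , a*-uncharged
    where
    a*-uncharged : ∀ i j → charge i j ≢ inj₁ a*
    a*-uncharged i j c with charge≡inj₁ c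
    ... | refl , a*≤j = a*≰b* (ℚ.≤-trans a*≤j (b*-max j))

argmax-Fin : ∀ {n} (f : Fin n → ℚ) → Fin n → Σ (Fin n) λ k → ∀ i → f i ℚ.≤ f k
argmax-Fin {n} f i₀ = argmax f i₀ (allFin n) , λ i → lookup (f[xs]≤f[argmax] i₀ (allFin n)) (∈-allFin i)

↣⇒≤ : ∀ {m n} {A B : Set} → Fin m ↔ A → Fin n ↔ B → A ↣ B → m ≤ n
↣⇒≤ m↔A n↔B f = injective⇒≤ (Injection.injective (↔⇒↣ (↔-sym n↔B) ↣-∘ (f ↣-∘ ↔⇒↣ m↔A)))

[,]-injective : ∀ {A B C : Set} {f : A → C} {g : B → C} → Injective _≡_ _≡_ f → Injective _≡_ _≡_ g →
                (∀ a b → f a ≢ g b) → Injective _≡_ _≡_ [ f , g ]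
[,]-injective f-inj g-inj f≢g {inj₁ a} {inj₁ a'} e = cong inj₁ (f-inj e)
[,]-injective f-inj g-inj f≢g {inj₂ b} {inj₂ b'} e = cong inj₂ (g-inj e)
[,]-injective f-inj g-inj f≢g {inj₁ a} {inj₂ b}  e = contradiction e (f≢g a b)
[,]-injective f-inj g-inj f≢g {inj₂ b} {inj₁ a}  e = contradiction (sym e) (f≢g a b)

avoiding-injection-bound : ∀ {p q} (f : Fin p × Fin q → (Fin p ⊎ Fin q) ⊎ (Fin p ⊎ Fin q)) →
                           Injective _≡_ _≡_ f → ∀ u v → (∀ x → f x ≢ inj₁ u) → (∀ x → f x ≢ inj₂ v) →
                           p * q + 2 ≤ (p + q) + (p + q)
avoiding-injection-bound {p} {q} f f-inj u v f≢u f≢v =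
  ↣⇒≤ (↔-trans +↔⊎ (*↔× ⊎-↔ ↔-refl)) (↔-trans +↔⊎ (+↔⊎ ⊎-↔ +↔⊎))
      (mk↣ ([,]-injective f-inj missed-injective f≢missed))
  where
  missed : Fin 2 → (Fin p ⊎ Fin q) ⊎ (Fin p ⊎ Fin q)
  missed zero       = inj₁ u
  missed (suc zero) = inj₂ v

  missed-injective : Injective _≡_ _≡_ missed
  missed-injective {zero}     {zero}     _ = refl
  missed-injective {suc zero} {suc zero} _ = refl
  missed-injective {zero}     {suc zero} ()
  missed-injective {suc zero} {zero}     ()

  f≢missed : ∀ x k → f x ≢ missed k
  f≢missed x zero       = f≢u x
  f≢missed x (suc zero) = f≢v x

representation-bound : ∀ {p q} → Representation p q → Fin p → Fin q → p * q + 2 ≤ (p + q) + (p + q)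
representation-bound {p} {q} ρ i₀ j₀ =
  avoiding-injection-bound code code-injective (proj₁ y-miss) (proj₁ x-miss)
    (λ (i , j) → encode≢y-miss (visible i j)) (λ (i , j) → encode≢x-miss (visible i j))
  where
  open Representation ρ
  module X = Charging x₁ x₂ left right (λ o → left-hidden _ _ (inj₂ o)) (λ o → right-hidden _ _ (inj₂ o))
  module Y = Charging y₁ y₂ left right (λ o → left-hidden _ _ (inj₁ o)) (λ o → right-hidden _ _ (inj₁ o))

  x-miss : Σ (Fin p ⊎ Fin q) λ v → ∀ i j → X.charge i j ≢ v
  x-miss = X.charge-misses (argmax-Fin (x₂ ∘ left) i₀) (argmax-Fin (x₂ ∘ right) j₀)

  y-miss : Σ (Fin p ⊎ Fin q) λ v → ∀ i j → Y.charge i j ≢ v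
  y-miss = Y.charge-misses (argmax-Fin (y₂ ∘ left) i₀) (argmax-Fin (y₂ ∘ right) j₀)

  encode : ∀ {i j} → Visible (left i) (right j) → (Fin p ⊎ Fin q) ⊎ (Fin p ⊎ Fin q)
  encode {i} {j} = Sum.map (const (Y.charge i j)) (const (X.charge i j))

  encode-injective : ∀ {i j i' j'} (v : Visible (left i) (right j)) (v' : Visible (left i') (right j')) →
                     encode v ≡ encode v' → (i , j) ≡ (i' , j')
  encode-injective (inj₁ y) (inj₁ y') e = Y.charge-injective y y' (inj₁-injective e)
  encode-injective (inj₂ x) (inj₂ x') e = X.charge-injective x x' (inj₂-injective e)

  encode≢y-miss : ∀ {i j} (v : Visible (left i) (right j)) → encode v ≢ inj₁ (proj₁ y-miss)
  encode≢y-miss {i} {j} (inj₁ _) e = proj₂ y-miss i j (inj₁-injective e)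
  encode≢y-miss         (inj₂ _) ()

  encode≢x-miss : ∀ {i j} (v : Visible (left i) (right j)) → encode v ≢ inj₂ (proj₁ x-miss)
  encode≢x-miss         (inj₁ _) ()
  encode≢x-miss {i} {j} (inj₂ _) e = proj₂ x-miss i j (inj₂-injective e)

  code : Fin p × Fin q → (Fin p ⊎ Fin q) ⊎ (Fin p ⊎ Fin q)
  code (i , j) = encode (visible i j)

  code-injective : Injective _≡_ _≡_ code
  code-injective {i , j} {i' , j'} = encode-injective (visible i j) (visible i' j')

bound⇒p≡3∧q≡3∨q≡4 : ∀ {p q} → 3 ≤ p → p ≤ q → p * q + 2 ≤ (p + q) + (p + q) → p ≡ 3 × (q ≡ 3 ⊎ q ≡ 4)
bound⇒p≡3∧q≡3∨q≡4 {p} {q} 3≤p p≤q bound with ≤-antisym (s≤s⁻¹ p<4) 3≤p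
  where
  open ≤-Reasoning
  p<4 : p ℕ.< 4
  p<4 = *-cancelʳ-< q p 4 (begin-strict
    p * q               <⟨ m<m+n (p * q) z<s ⟩
    p * q + 2           ≤⟨ bound ⟩
    (p + q) + (p + q)   ≤⟨ +-mono-≤ (+-monoˡ-≤ q p≤q) (+-monoˡ-≤ q p≤q) ⟩
    (q + q) + (q + q)   ≡⟨ solve (q ∷ []) ⟩
    4 * q               ∎)
... | refl = refl , q≡3⊎q≡4 (s≤s⁻¹ (s≤s⁻¹ (+-cancelˡ-≤ (q + q) _ _ (begin
    (q + q) + (2 + q)   ≡⟨ solve (q ∷ []) ⟩
    3 * q + 2           ≤⟨ bound ⟩
    (3 + q) + (3 + q)   ≡⟨ solve (q ∷ []) ⟩
    (q + q) + 6         ∎))))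
  where
  open ≤-Reasoning
  q≡3⊎q≡4 : q ≤ 4 → q ≡ 3 ⊎ q ≡ 4
  q≡3⊎q≡4 q≤4 with m≤n⇒m<n∨m≡n q≤4
  ... | inj₁ q<4 = inj₁ (≤-antisym (s≤s⁻¹ q<4) p≤q)
  ... | inj₂ q≡4 = inj₂ q≡4

theorem1p3 : (p q : ℕ) → 1 ≤ p → p ≤ q →
    (K-TRVG p q ⇔ (p ≤ 2 ⊎ (p ≡ 3 × (q ≡ 3 ⊎ q ≡ 4))))
theorem1p3 p q 1≤p p≤q = mk⇔ (necessary ∘ Equivalence.to K-TRVG⇔Representation)
                             (Equivalence.from K-TRVG⇔Representation ∘ sufficient)
  where
  necessary : Representation p q → p ≤ 2 ⊎ (p ≡ 3 × (q ≡ 3 ⊎ q ≡ 4))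
  necessary ρ with p ≤? 2
  ... | yes p≤2 = inj₁ p≤2
  ... | no p≰2  = inj₂ (bound⇒p≡3∧q≡3∨q≡4 (≰⇒> p≰2) p≤q
                          (representation-bound ρ (fromℕ< 1≤p) (fromℕ< (≤-trans 1≤p p≤q))))

  sufficient : p ≤ 2 ⊎ (p ≡ 3 × (q ≡ 3 ⊎ q ≡ 4)) → Representation p q
  sufficient (inj₁ p≤2)                = restrict p≤2 ≤-refl (K₂,q-representation q)
  sufficient (inj₂ (refl , inj₁ refl)) = restrict ≤-refl (n≤1+n 3) K₃,₄-representation
  sufficient (inj₂ (refl , inj₂ refl)) = K₃,₄-representation
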